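{- For any nonempty partition $\mu$, $d(\mu^r)=d(\mu)$ if and only if $\mu_{d(\mu)+1}=d(\mu)$.
   Context: For a partition $\lambda$ set $\lambda_t=0$ for $t>\ell(\lambda)$; $d(\lambda)$ is the largest $i\ge1$ with $\lambda_i\ge i$ (length of the diagonal; $d(\emptyset)=0$). The Maya diagram of $\lambda$ is $S(\lambda)=\{\lambda_t-t+\tfrac12:t\ge1\}$. For $S\subseteq\mathbb{Z}+\tfrac12$ let $S^+=\{x\in S:x>0\}$, $S^-=\{x\in(\mathbb{Z}+\tfrac12)\setminus S:x<0\}$; if finite, $c(S)=|S^+|-|S^-|$ and $\{s-c(S):s\in S\}$ is the Maya diagram of a unique partition, the partition associated to $S$. For nonempty $\mu$ with $S=S(\mu)$, $\mu^r$ is the partition associated to $S\setminus\{\min S^+\}$. -}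

module Defs where

open import Data.Nat as ℕ using (ℕ; zero; suc; _∸_; _≤ᵇ_; _⊔_)
open import Data.Integer as ℤ using (ℤ; +_; _-_; _+_; -[1+_])
open import Data.Bool using (if_then_else_)
open import Data.List using (List; []; _∷_; length; map; foldr; applyUpTo)
open import Data.List.Relation.Unary.All using (All)
open import Data.List.Relation.Unary.Linked using (Linked)
open import Data.List.Relation.Unary.Unique.Propositional using (Unique)
open import Data.List.Membership.Propositional using (_∈_)
open import Data.Product using (Σ; ∃; _×_)
open import Function.Bundles using (_⇔_)
open import Relation.Nullary using (¬_)
open import Relation.Binary.PropositionalEquality using (_≡_; _≢_)

record Partition : Set where
  constructor mkPartition
  field
    parts      : List ℕ
    decreasing : Linked (λ a b → b ℕ.≤ a) parts
    positive   : All (λ a → 0 ℕ.< a) parts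
open Partition public

len : Partition → ℕ
len λ′ = length (parts λ′)

nth : List ℕ → ℕ → ℕ
nth []       _       = 0
nth (x ∷ xs) zero    = x
nth (x ∷ xs) (suc n) = nth xs n

-- part λ t = λ_t  (1-indexed; λ_t = 0 for t > ℓ(λ); the value at t = 0 is never used)
part : Partition → ℕ → ℕ
part λ′ t = nth (parts λ′) (t ∸ 1)

-- d(λ): the largest i ≥ 1 with λ_i ≥ i, or 0 if there is none.
-- (Any such i satisfies i ≤ λ_i, hence λ_i > 0, hence i ≤ ℓ(λ); so it suffices to
--  take the maximum over i ∈ {1,…,ℓ(λ)}.)
diag : Partition → ℕ
diag λ′ = foldr _⊔_ 0
  (map (λ i → if i ≤ᵇ part λ′ i then i else 0) (applyUpTo suc (len λ′)))

-- Subsets of ℤ + 1/2 are encoded as predicates on ℤ: the integer x stands for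
-- the half-integer x + 1/2.  Then x + 1/2 > 0 iff 0 ≤ x, and x + 1/2 < 0 iff x < 0.
HalfSet : Set₁
HalfSet = ℤ → Set

maya : Partition → HalfSet
maya λ′ x = Σ ℕ λ t → 1 ℕ.≤ t × (+ part λ′ t) - (+ t) ≡ x

HasCard : (ℤ → Set) → ℕ → Set
HasCard P n = Σ (List ℤ) λ L → Unique L × (∀ x → (x ∈ L) ⇔ P x) × length L ≡ n

Plus : HalfSet → HalfSet
Plus S x = S x × ℤ.0ℤ ℤ.≤ x

Minus : HalfSet → HalfSet
Minus S x = ¬ S x × x ℤ.< ℤ.0ℤ

Charge : HalfSet → ℤ → Set
Charge S c = Σ ℕ λ p → Σ ℕ λ q →
  HasCard (Plus S) p × HasCard (Minus S) q × c ≡ (+ p) - (+ q)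

AssociatedTo : HalfSet → Partition → Set
AssociatedTo S ν = Σ ℤ λ c → Charge S c ×
  (∀ x → maya ν x ⇔ (Σ ℤ λ s → S s × x ≡ s - c))

IsMinPlus : HalfSet → ℤ → Set
IsMinPlus S m = Plus S m × (∀ y → Plus S y → m ℤ.≤ y)

remove : HalfSet → ℤ → HalfSet
remove S m x = S x × x ≢ m

IsMuR : Partition → Partition → Set
IsMuR μ ν = Σ ℤ λ m → IsMinPlus (maya μ) m × AssociatedTo (remove (maya μ) m) ν

Nonempty : Partition → Set
Nonempty μ = 1 ℕ.≤ len μ

-- Let d = d(μ) ≥ 1 and aₜ = μₜ − t, so that S(μ) = {aₜ + 1/2 : t ≥ 1}. The beads aₜ strictly
-- decrease and aₜ ≥ 0 exactly when t ≤ d, so S⁺ = {a₁, …, a_d} and min S⁺ = a_d; counting the gaps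
-- of S in [−ℓ(μ), 0) gives |S⁻| = d. Removing a_d thus leaves charge −1, and shifting the remaining
-- beads up by one yields μʳₜ = μₜ + 1 for t < d and μʳₜ = μ_{t+1} for t ≥ d. A Maya diagram
-- determines its partition, so this is the only μʳ, and d(μʳ) = d iff d ≤ μʳ_d = μ_{d+1}; since
-- always μ_{d+1} ≤ d, that means μ_{d+1} = d.

module Submission where

open import Defs
open import Data.Nat as ℕ using (ℕ; zero; suc; pred; _∸_; _⊔_; z≤n; s≤s; _≤_; _<_; _≤?_; _<?_)
import Data.Nat.Properties as ℕ
open import Data.Integer as ℤ using (ℤ; +_; -[1+_]; _-_; 0ℤ; 1ℤ; -1ℤ; +≤+; +<+; -<+)
import Data.Integer.Properties as ℤ
open import Data.Integer.Tactic.RingSolver using (solve-∀)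
open import Data.Nat.Induction using (<-rec)
open import Data.List using (List; []; _∷_; _++_; length; foldr; applyUpTo; filter)
open import Data.List.Properties using (length-applyUpTo; length-++-sucʳ; foldr-preservesᵇ; foldr-preservesᵒ)
open import Data.List.Relation.Unary.All as All using (All; []; _∷_)
import Data.List.Relation.Unary.All.Properties as AllP
open import Data.List.Relation.Unary.Linked using (Linked; []; [-]; _∷_)
import Data.List.Relation.Unary.Linked.Properties as LinkedP
open import Data.List.Relation.Unary.Any as Any using (here; there)
open import Data.List.Membership.Propositional using (_∈_; _∉_)
open import Data.List.Membership.Propositional.Properties
  using (∈-applyUpTo⁺; ∈-applyUpTo⁻; ∈-map⁺; ∈-∃++; ∈-++⁻; ∈-++⁺ˡ; ∈-++⁺ʳ; ∈-filter⁺; ∈-filter⁻)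
open import Data.List.Membership.DecPropositional ℤ._≟_ using (_∈?_)
open import Data.List.Relation.Binary.Subset.Propositional using (_⊆_)
open import Data.List.Relation.Unary.Unique.Propositional using (Unique; []; _∷_)
import Data.List.Relation.Unary.Unique.Propositional.Properties as Unique
open import Data.Product using (Σ; _×_; _,_; proj₁; proj₂)
open import Data.Sum using (inj₁; inj₂; [_,_]′)
open import Data.Bool using (true; false; if_then_else_)
open import Relation.Nullary.Reflects using (ofʸ; ofⁿ)
open import Function.Bundles using (_⇔_; mk⇔; Equivalence)
open import Relation.Binary.PropositionalEquality
open import Relation.Nullary using (¬_; Dec; yes; no; contradiction)
open import Relation.Binary.Definitions using (tri<; tri≈; tri>)
open import Relation.Unary using (Decidable)
open import Relation.Unary.Properties using (∁?)
open import Function.Base using (_∘_; id)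

open Equivalence using (to; from)

-- Both sides are compared after adding b + e, which clears the subtractions.
module _ (a b c e : ℕ) where

  private
    shift : ∀ (x y w : ℤ) → (x - y) ℤ.+ (y ℤ.+ w) ≡ x ℤ.+ w
    shift = solve-∀

    unshift : ∀ (x y w : ℤ) → (x ℤ.+ w) - (y ℤ.+ w) ≡ x - y
    unshift = solve-∀

    common : ℤ
    common = + b ℤ.+ + e

    lhs : (+ a - + b) ℤ.+ common ≡ + (a ℕ.+ e)
    lhs = trans (shift (+ a) (+ b) (+ e)) (sym (ℤ.pos-+ a e))

    rhs : (+ c - + e) ℤ.+ common ≡ + (c ℕ.+ b)
    rhs = trans (cong (λ u → (+ c - + e) ℤ.+ u) (ℤ.+-comm (+ b) (+ e)))
            (trans (shift (+ c) (+ e) (+ b)) (sym (ℤ.pos-+ c b)))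

    lhs⁻¹ : + (a ℕ.+ e) - common ≡ + a - + b
    lhs⁻¹ = trans (cong (λ u → u - common) (ℤ.pos-+ a e)) (unshift (+ a) (+ b) (+ e))

    rhs⁻¹ : + (c ℕ.+ b) - common ≡ + c - + e
    rhs⁻¹ = trans (cong₂ _-_ (ℤ.pos-+ c b) (ℤ.+-comm (+ b) (+ e)))
              (unshift (+ c) (+ e) (+ b))

  diff≡diff⇔ : (+ a - + b ≡ + c - + e) ⇔ (a ℕ.+ e ≡ c ℕ.+ b)
  diff≡diff⇔ = mk⇔
    (λ eq → ℤ.+-injective (trans (sym lhs) (trans (cong (λ u → u ℤ.+ common) eq) rhs)))
    (λ eq → trans (sym lhs⁻¹) (trans (cong (λ n → + n - common) eq) rhs⁻¹))

  diff≤diff⇔ : (+ a - + b ℤ.≤ + c - + e) ⇔ (a ℕ.+ e ≤ c ℕ.+ b)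
  diff≤diff⇔ = mk⇔
    (λ le → ℤ.drop‿+≤+ (subst₂ ℤ._≤_ lhs rhs (ℤ.+-monoˡ-≤ common le)))
    (λ le → subst₂ ℤ._≤_ lhs⁻¹ rhs⁻¹ (ℤ.+-monoˡ-≤ (ℤ.- common) (+≤+ le)))

suc-diff : ∀ p t → + suc p - + t ≡ (+ p - + t) ℤ.+ 1ℤ
suc-diff p t = lemma (+ p) (+ t)
  where
  lemma : ∀ (p t : ℤ) → (1ℤ ℤ.+ p) - t ≡ (p - t) ℤ.+ 1ℤ
  lemma = solve-∀

diff-suc : ∀ p t → + p - + t ≡ (+ p - + suc t) ℤ.+ 1ℤ
diff-suc p t = lemma (+ p) (+ t)
  where
  lemma : ∀ (p t : ℤ) → p - t ≡ (p - (1ℤ ℤ.+ t)) ℤ.+ 1ℤ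
  lemma = solve-∀

diff-negative : ∀ {p t} → p < t → + p - + t ≡ -[1+ (t ∸ suc p) ]
diff-negative {p} {t} p<t = from (diff≡diff⇔ p t 0 (suc (t ∸ suc p)))
  (trans (ℕ.+-suc p (t ∸ suc p)) (ℕ.m+[n∸m]≡n p<t))

-- Parts and beads

nth-antitone : ∀ {xs} → Linked (λ a b → b ≤ a) xs → ∀ {i j} → i ≤ j → nth xs j ≤ nth xs i
nth-antitone []        _                            = z≤n
nth-antitone [-]       {zero}  {zero}  _            = ℕ.≤-refl
nth-antitone [-]       {zero}  {suc j} _            = z≤n
nth-antitone [-]       {suc i} {suc j} _            = z≤n
nth-antitone (_ ∷ _)   {zero}  {zero}  _            = ℕ.≤-refl
nth-antitone (y≤x ∷ l) {zero}  {suc j} _            = ℕ.≤-trans (nth-antitone l {0} {j} z≤n) y≤x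
nth-antitone (_ ∷ l)   {suc i} {suc j} (s≤s i≤j)    = nth-antitone l i≤j

nth-beyond : ∀ xs {i} → length xs ≤ i → nth xs i ≡ 0
nth-beyond []       _         = refl
nth-beyond (x ∷ xs) (s≤s len≤i) = nth-beyond xs len≤i

nth-positive : ∀ {xs} → All (λ a → 0 < a) xs → ∀ {i} → i < length xs → 0 < nth xs i
nth-positive (x>0 ∷ _)   {zero}  _         = x>0
nth-positive (_ ∷ xs>0) {suc i} (s≤s i<len) = nth-positive xs>0 i<len

part-antitone : ∀ α {i j} → i ≤ j → part α j ≤ part α i
part-antitone α i≤j = nth-antitone (decreasing α) (ℕ.∸-monoˡ-≤ 1 i≤j)

part-beyond : ∀ α {t} → len α < t → part α t ≡ 0
part-beyond α {suc t} (s≤s len≤t) = nth-beyond (parts α) len≤t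

part-positive : ∀ α {t} → 1 ≤ t → t ≤ len α → 0 < part α t
part-positive α {suc t} _ t<len = nth-positive (positive α) t<len

positive⇒≤len : ∀ α {t} → 0 < part α t → t ≤ len α
positive⇒≤len α {t} part>0 with t ≤? len α
... | yes t≤len = t≤len
... | no  t≰len = contradiction (part-beyond α (ℕ.≰⇒> t≰len)) (ℕ.>⇒≢ part>0)

bead : Partition → ℕ → ℤ
bead α t = + part α t - + t

bead-antitone : ∀ α {i j} → i ≤ j → bead α j ℤ.≤ bead α i
bead-antitone α {i} {j} i≤j =
  from (diff≤diff⇔ (part α j) j (part α i) i) (ℕ.+-mono-≤ (part-antitone α i≤j) i≤j)

bead-distinct : ∀ α {i j} → i < j → bead α i ≢ bead α j
bead-distinct α {i} {j} i<j eq =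
  ℕ.<⇒≢ (ℕ.+-mono-≤-< (part-antitone α (ℕ.<⇒≤ i<j)) i<j)
    (sym (to (diff≡diff⇔ (part α i) i (part α j) j) eq))

0≤bead⇔≤part : ∀ α t → 0ℤ ℤ.≤ bead α t ⇔ t ≤ part α t
0≤bead⇔≤part α t = mk⇔
  (λ 0≤b → subst (t ≤_) (ℕ.+-identityʳ _) (to (diff≤diff⇔ 0 0 (part α t) t) 0≤b))
  (λ t≤p → from (diff≤diff⇔ 0 0 (part α t) t) (subst (t ≤_) (sym (ℕ.+-identityʳ _)) t≤p))

private
  part≤part-of-maya⊆ : ∀ α β {t} → (∀ {i} → i < t → 1 ≤ i → part α i ≡ part β i) →
    (∀ {x} → maya α x → maya β x) → 1 ≤ t → part α t ≤ part β t
  part≤part-of-maya⊆ α β {t} agree α⊆β 1≤t with α⊆β (t , 1≤t , refl)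
  ... | t′ , 1≤t′ , bβt′≡bαt with t′ <? t
  ...   | yes t′<t = contradiction
            (trans (cong (λ p → + p - + t′) (agree t′<t 1≤t′)) bβt′≡bαt) (bead-distinct α t′<t)
  ...   | no  t′≮t = ℕ.+-cancelʳ-≤ t _ _ (to (diff≤diff⇔ (part α t) t (part β t) t)
            (subst (ℤ._≤ bead β t) bβt′≡bαt (bead-antitone β (ℕ.≮⇒≥ t′≮t))))

maya-injective : ∀ α β → (∀ x → maya α x ⇔ maya β x) → ∀ t → part α t ≡ part β t
maya-injective α β α≈β zero    = maya-injective α β α≈β 1  -- part α 0 is part α 1, as 0 ∸ 1 = 0
maya-injective α β α≈β (suc t) = <-rec (λ t → 1 ≤ t → part α t ≡ part β t) step (suc t) (s≤s z≤n)
  where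
  step : ∀ t → (∀ {i} → i < t → 1 ≤ i → part α i ≡ part β i) → 1 ≤ t → part α t ≡ part β t
  step t agree 1≤t = ℕ.≤-antisym
    (part≤part-of-maya⊆ α β agree (λ {x} → to (α≈β x)) 1≤t)
    (part≤part-of-maya⊆ β α (λ i<t 1≤i → sym (agree i<t 1≤i)) (λ {x} → from (α≈β x)) 1≤t)

-- The diagonal

∈⇒≤foldr-⊔ : ∀ {x xs} → x ∈ xs → x ≤ foldr _⊔_ 0 xs
∈⇒≤foldr-⊔ x∈xs = foldr-preservesᵒ
  (λ m n → λ { (inj₁ x≤m) → ℕ.m≤n⇒m≤n⊔o n x≤m ; (inj₂ x≤n) → ℕ.m≤n⇒m≤o⊔n m x≤n })
  0 _ (inj₂ (Any.map ℕ.≤-reflexive x∈xs))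

-- _⊔_ returns one of its arguments, and every term k of the fold has k ≤ part α k.
diag-≤-part : ∀ α → diag α ≤ part α (diag α)
diag-≤-part α = foldr-preservesᵇ
  (λ {m} {n} m≤pm n≤pn → [ (λ eq → subst (λ k → k ≤ part α k) (sym eq) m≤pm)
                          , (λ eq → subst (λ k → k ≤ part α k) (sym eq) n≤pn) ]′ (ℕ.⊔-sel m n))
  z≤n (AllP.map⁺ (AllP.applyUpTo⁺₂ _ (len α) (λ i → term-≤-part (suc i))))
  where
  term-≤-part : ∀ i → let k = if i ℕ.≤ᵇ part α i then i else 0 in k ≤ part α k
  term-≤-part i with i ℕ.≤ᵇ part α i | ℕ.≤ᵇ-reflects-≤ i (part α i)
  ... | true  | ofʸ i≤p = i≤p
  ... | false | _       = z≤n

≤-diag : ∀ α {i} → i ≤ part α i → i ≤ diag α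
≤-diag α {zero}  _   = z≤n
≤-diag α {suc k} i≤p = ℕ.≤-trans (ℕ.≤-reflexive (sym term≡i))
  (∈⇒≤foldr-⊔ (∈-map⁺ _ (∈-applyUpTo⁺ suc (positive⇒≤len α (ℕ.<-≤-trans (s≤s z≤n) i≤p)))))
  where
  term≡i : (if suc k ℕ.≤ᵇ part α (suc k) then suc k else 0) ≡ suc k
  term≡i with suc k ℕ.≤ᵇ part α (suc k) | ℕ.≤ᵇ-reflects-≤ (suc k) (part α (suc k))
  ... | true  | _        = refl
  ... | false | ofⁿ i≰p = contradiction i≤p i≰p

part-suc-diag≤diag : ∀ α → part α (suc (diag α)) ≤ diag α
part-suc-diag≤diag α with suc (diag α) ≤? part α (suc (diag α))
... | yes d<p = contradiction (≤-diag α d<p) (ℕ.<-irrefl refl)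
... | no  d≮p = ℕ.≤-pred (ℕ.≰⇒> d≮p)

diag-unique : ∀ α {k} → k ≤ part α k → part α (suc k) ≤ k → diag α ≡ k
diag-unique α {k} k≤p p≤k = ℕ.≤-antisym diag≤k (≤-diag α k≤p)
  where
  diag≤k : diag α ≤ k
  diag≤k with diag α ≤? k
  ... | yes d≤k = d≤k
  ... | no  d≰k = contradiction
          (ℕ.≤-trans (diag-≤-part α) (ℕ.≤-trans (part-antitone α (ℕ.≰⇒> d≰k)) p≤k))
          d≰k

≤diag⇔≤part : ∀ α t → t ≤ diag α ⇔ t ≤ part α t
≤diag⇔≤part α t = mk⇔
  (λ t≤d → ℕ.≤-trans t≤d (ℕ.≤-trans (diag-≤-part α) (part-antitone α t≤d)))
  (≤-diag α)

diag≤len : ∀ α → diag α ≤ len α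
diag≤len α with diag α | diag-≤-part α
... | zero  | _       = z≤n
... | suc d | d<part = positive⇒≤len α (ℕ.<-≤-trans (s≤s z≤n) d<part)

0≤bead⇔≤diag : ∀ α t → 0ℤ ℤ.≤ bead α t ⇔ t ≤ diag α
0≤bead⇔≤diag α t = mk⇔
  (from (≤diag⇔≤part α t) ∘ to (0≤bead⇔≤part α t))
  (from (0≤bead⇔≤part α t) ∘ to (≤diag⇔≤part α t))

diag-cong : ∀ α β → part α ≗ part β → diag α ≡ diag β
diag-cong α β α≗β = sym (diag-unique β
  (subst (diag α ≤_) (α≗β (diag α)) (diag-≤-part α))
  (subst (_≤ diag α) (α≗β (suc (diag α))) (part-suc-diag≤diag α)))

Unique-⊆⇒length≤ : ∀ {A : Set} {xs ys : List A} → Unique xs → xs ⊆ ys → length xs ≤ length ys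
Unique-⊆⇒length≤ {xs = []}     _            _     = z≤n
Unique-⊆⇒length≤ {xs = x ∷ xs} (x∉xs ∷ uxs) x∷xs⊆ys with ∈-∃++ (x∷xs⊆ys (here refl))
... | us , vs , refl = subst (suc (length xs) ≤_) (sym (length-++-sucʳ us x vs))
  (s≤s (Unique-⊆⇒length≤ uxs xs⊆us++vs))
  where
  xs⊆us++vs : xs ⊆ us ++ vs
  xs⊆us++vs {y} y∈xs with ∈-++⁻ us (x∷xs⊆ys (there y∈xs))
  ... | inj₁ y∈us          = ∈-++⁺ˡ y∈us
  ... | inj₂ (here refl)   = contradiction refl (All.lookup x∉xs y∈xs)
  ... | inj₂ (there y∈vs) = ∈-++⁺ʳ us y∈vs

HasCard-unique : ∀ {P m n} → HasCard P m → HasCard P n → m ≡ n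
HasCard-unique (xs , uxs , xs≈P , refl) (ys , uys , ys≈P , refl) = ℕ.≤-antisym
  (Unique-⊆⇒length≤ uxs (λ {x} x∈xs → from (ys≈P x) (to (xs≈P x) x∈xs)))
  (Unique-⊆⇒length≤ uys (λ {x} x∈ys → from (xs≈P x) (to (ys≈P x) x∈ys)))

HasCard-resp : ∀ {P Q n} → (∀ x → P x ⇔ Q x) → HasCard P n → HasCard Q n
HasCard-resp P≈Q (xs , uxs , xs≈P , len) =
  xs , uxs , (λ x → mk⇔ (to (P≈Q x) ∘ to (xs≈P x)) (from (xs≈P x) ∘ from (P≈Q x))) , len

length-filter+length-filter-∁ : ∀ {A : Set} {P : A → Set} (P? : Decidable P) xs →
  length (filter P? xs) ℕ.+ length (filter (∁? P?) xs) ≡ length xs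
length-filter+length-filter-∁ P? []       = refl
length-filter+length-filter-∁ P? (x ∷ xs) with P? x
... | yes _ = cong suc (length-filter+length-filter-∁ P? xs)
... | no  _ = trans (ℕ.+-suc _ _) (cong suc (length-filter+length-filter-∁ P? xs))

HasCard-∖ : ∀ {W A} → Unique W → Unique A → A ⊆ W →
  HasCard (λ x → x ∈ W × x ∉ A) (length W ∸ length A)
HasCard-∖ {W} {A} uW uA A⊆W =
  outside , Unique.filter⁺ ∉A? uW ,
  (λ x → mk⇔ (∈-filter⁻ ∉A? {xs = W}) (λ (x∈W , x∉A) → ∈-filter⁺ ∉A? x∈W x∉A)) ,
  sym (begin
    length W ∸ length A                              ≡⟨ cong₂ _∸_ (sym |inside|+|outside|) (sym |inside|≡|A|) ⟩
    length inside ℕ.+ length outside ∸ length inside ≡⟨ ℕ.m+n∸m≡n (length inside) _ ⟩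
    length outside                                   ∎)
  where
  open ≡-Reasoning
  ∉A? : Decidable (_∉ A)
  ∉A? = ∁? (_∈? A)

  inside outside : List ℤ
  inside  = filter (_∈? A) W
  outside = filter ∉A? W

  |inside|+|outside| : length inside ℕ.+ length outside ≡ length W
  |inside|+|outside| = length-filter+length-filter-∁ (_∈? A) W

  |inside|≡|A| : length inside ≡ length A
  |inside|≡|A| = HasCard-unique {_∈ A}
    (inside , Unique.filter⁺ (_∈? A) uW ,
     (λ x → mk⇔ (proj₂ ∘ ∈-filter⁻ (_∈? A) {xs = W}) (λ x∈A → ∈-filter⁺ (_∈? A) (A⊆W x∈A) x∈A)) ,
     refl)
    (A , uA , (λ x → mk⇔ id id) , refl)

HasCard-remove : ∀ {P n m} → HasCard P n → P m → HasCard (λ x → P x × x ≢ m) (n ∸ 1)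
HasCard-remove {m = m} (xs , uxs , xs≈P , refl) Pm = HasCard-resp
  (λ x → mk⇔ (λ (x∈xs , x∉[m]) → to (xs≈P x) x∈xs , x∉[m] ∘ here)
             (λ (Px , x≢m) → from (xs≈P x) Px , λ { (here x≡m) → x≢m x≡m }))
  (HasCard-∖ uxs ([] ∷ []) λ { (here refl) → from (xs≈P m) Pm })

-- Uniqueness of μʳ

IsMinPlus-unique : ∀ {S m m′} → IsMinPlus S m → IsMinPlus S m′ → m ≡ m′
IsMinPlus-unique (Sm , m-min) (Sm′ , m′-min) = ℤ.≤-antisym (m-min _ Sm′) (m′-min _ Sm)

Charge-unique : ∀ {S c c′} → Charge S c → Charge S c′ → c ≡ c′
Charge-unique (p , q , |S⁺|≡p , |S⁻|≡q , refl) (p′ , q′ , |S⁺|≡p′ , |S⁻|≡q′ , refl) =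
  cong₂ (λ p q → + p - + q) (HasCard-unique |S⁺|≡p |S⁺|≡p′) (HasCard-unique |S⁻|≡q |S⁻|≡q′)

AssociatedTo-unique : ∀ {S} ν ν′ → AssociatedTo S ν → AssociatedTo S ν′ → part ν ≗ part ν′
AssociatedTo-unique ν ν′ (c , chg , ν≈S-c) (c′ , chg′ , ν′≈S-c′) with Charge-unique chg chg′
... | refl = maya-injective ν ν′ λ x →
  mk⇔ (from (ν′≈S-c′ x) ∘ to (ν≈S-c x)) (from (ν≈S-c x) ∘ to (ν′≈S-c′ x))

IsMuR-unique : ∀ μ ν ν′ → IsMuR μ ν → IsMuR μ ν′ → part ν ≗ part ν′
IsMuR-unique μ ν ν′ (m , m-min , ν-assoc) (m′ , m′-min , ν′-assoc) with IsMinPlus-unique m-min m′-min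
... | refl = AssociatedTo-unique ν ν′ ν-assoc ν′-assoc

-- Charge of a Maya diagram

Plus-maya⇔ : ∀ α x → Plus (maya α) x ⇔ (Σ ℕ λ t → (1 ≤ t × t ≤ diag α) × bead α t ≡ x)
Plus-maya⇔ α x = mk⇔
  (λ { ((t , 1≤t , refl) , 0≤x) → t , (1≤t , to (0≤bead⇔≤diag α t) 0≤x) , refl })
  (λ { (t , (1≤t , t≤d) , refl) → (t , 1≤t , refl) , from (0≤bead⇔≤diag α t) t≤d })

HasCard-Plus-maya : ∀ α → HasCard (Plus (maya α)) (diag α)
HasCard-Plus-maya α =
  applyUpTo (bead α ∘ suc) (diag α) ,
  Unique.applyUpTo⁺₁ _ (diag α) (λ i<j _ → bead-distinct α (s≤s i<j)) ,
  (λ x → mk⇔ (from (Plus-maya⇔ α x) ∘ listed) (unlisted ∘ to (Plus-maya⇔ α x))) ,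
  length-applyUpTo _ (diag α)
  where
  listed : ∀ {x} → x ∈ applyUpTo (bead α ∘ suc) (diag α) →
    Σ ℕ λ t → (1 ≤ t × t ≤ diag α) × bead α t ≡ x
  listed x∈ with ∈-applyUpTo⁻ (bead α ∘ suc) x∈
  ... | i , i<d , refl = suc i , (s≤s z≤n , i<d) , refl
  unlisted : ∀ {x} → (Σ ℕ λ t → (1 ≤ t × t ≤ diag α) × bead α t ≡ x) →
    x ∈ applyUpTo (bead α ∘ suc) (diag α)
  unlisted (suc i , (_ , i<d) , refl) = ∈-applyUpTo⁺ (bead α ∘ suc) i<d

minPlus-maya : ∀ α → 1 ≤ diag α → IsMinPlus (maya α) (bead α (diag α))
minPlus-maya α 1≤d =
  from (Plus-maya⇔ α _) (diag α , (1≤d , ℕ.≤-refl) , refl) ,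
  λ y Sy⁺ → let (t , (_ , t≤d) , bt≡y) = to (Plus-maya⇔ α y) Sy⁺ in
    subst (bead α (diag α) ℤ.≤_) bt≡y (bead-antitone α t≤d)

-- Below −ℓ every point is a bead aₜ = −t with t > ℓ, and the beads in [−ℓ, 0) are a_{d+1}, …, a_ℓ;
-- so S⁻ is the complement of these ℓ − d beads in [−ℓ, 0).
HasCard-Minus-maya : ∀ α → HasCard (Minus (maya α)) (diag α)
HasCard-Minus-maya α =
  subst (HasCard (Minus (maya α))) |W|∸|A|≡d
    (HasCard-resp (λ x → mk⇔ W∖A⇒Minus (Minus⇒W∖A x)) (HasCard-∖ uW uA A⊆W))
  where
  N d : ℕ
  N = len α
  d = diag α

  W A : List ℤ
  W = applyUpTo -[1+_] N
  A = applyUpTo (λ i → bead α (suc d ℕ.+ i)) (N ∸ d)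

  uW : Unique W
  uW = Unique.applyUpTo⁺₁ -[1+_] N (λ i<j _ eq → ℕ.<⇒≢ i<j (ℤ.-[1+-injective eq))

  uA : Unique A
  uA = Unique.applyUpTo⁺₁ _ (N ∸ d) (λ i<j _ → bead-distinct α (s≤s (ℕ.+-monoʳ-< d i<j)))

  ∈A⇔ : ∀ x → x ∈ A ⇔ (Σ ℕ λ t → (d < t × t ≤ N) × bead α t ≡ x)
  ∈A⇔ x = mk⇔ listed unlisted
    where
    listed : x ∈ A → Σ ℕ λ t → (d < t × t ≤ N) × bead α t ≡ x
    listed x∈A with ∈-applyUpTo⁻ _ x∈A
    ... | i , i<N∸d , refl = suc d ℕ.+ i , (s≤s (ℕ.m≤m+n d i) ,
      subst (d ℕ.+ i <_) (ℕ.m+[n∸m]≡n (diag≤len α)) (ℕ.+-monoʳ-< d i<N∸d)) , refl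
    unlisted : (Σ ℕ λ t → (d < t × t ≤ N) × bead α t ≡ x) → x ∈ A
    unlisted (suc t , (s≤s d≤t , t<N) , refl) =
      subst (λ s → bead α (suc s) ∈ A) (ℕ.m+[n∸m]≡n d≤t)
        (∈-applyUpTo⁺ (λ i → bead α (suc d ℕ.+ i)) (ℕ.∸-monoˡ-< t<N d≤t))

  part<t : ∀ {t} → d < t → part α t < t
  part<t d<t = ℕ.≰⇒> (λ t≤p → ℕ.<⇒≱ d<t (from (≤diag⇔≤part α _) t≤p))

  A⊆W : A ⊆ W
  A⊆W x∈A with to (∈A⇔ _) x∈A
  ... | suc t , (d<t , t<N) , refl = subst (_∈ W) (sym (diff-negative (part<t d<t)))
    (∈-applyUpTo⁺ -[1+_] (ℕ.≤-<-trans (ℕ.m∸n≤m t (part α (suc t))) t<N))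

  Minus⇒W∖A : ∀ x → Minus (maya α) x → x ∈ W × x ∉ A
  Minus⇒W∖A (+ _)     (_ , +<+ ())
  Minus⇒W∖A -[1+ k ] (x∉S , _) = x∈W , λ x∈A →
    let (t , (d<t , _) , bt≡x) = to (∈A⇔ _) x∈A in x∉S (t , ℕ.≤-trans (s≤s z≤n) d<t , bt≡x)
    where
    x∈W : -[1+ k ] ∈ W
    x∈W with k <? N
    ... | yes k<N = ∈-applyUpTo⁺ -[1+_] k<N
    ... | no  k≮N = contradiction
      (suc k , s≤s z≤n , cong (λ p → + p - + suc k) (part-beyond α (s≤s (ℕ.≮⇒≥ k≮N))))
      x∉S

  W∖A⇒Minus : ∀ {x} → x ∈ W × x ∉ A → Minus (maya α) x
  W∖A⇒Minus (x∈W , x∉A) with ∈-applyUpTo⁻ -[1+_] x∈W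
  ... | k , k<N , refl = x∉S , -<+
    where
    x∉S : ¬ maya α -[1+ k ]
    x∉S (suc t , 1≤t , bt≡x) with suc t ≤? N
    ... | yes t<N = x∉A (from (∈A⇔ _) (suc t , (d<t , t<N) , bt≡x))
      where
      d<t : d < suc t
      d<t = ℕ.≰⇒> λ t≤d →
        ℤ.<⇒≱ -<+ (subst (0ℤ ℤ.≤_) bt≡x (from (0≤bead⇔≤diag α (suc t)) t≤d))
    ... | no  t≮N = ℕ.<⇒≢ (ℕ.<-≤-trans k<N (ℕ.≤-pred (ℕ.≰⇒> t≮N)))
      (ℤ.-[1+-injective (trans (sym bt≡x) beyond))
      where
      beyond : bead α (suc t) ≡ -[1+ t ]
      beyond = cong (λ p → + p - + suc t) (part-beyond α (ℕ.≰⇒> t≮N))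

  |W|∸|A|≡d : length W ∸ length A ≡ d
  |W|∸|A|≡d = trans (cong₂ _∸_ (length-applyUpTo _ N) (length-applyUpTo _ (N ∸ d)))
    (ℕ.m∸[m∸n]≡n (diag≤len α))

Charge-remove-minPlus : ∀ α → 1 ≤ diag α → Charge (remove (maya α) (bead α (diag α))) -1ℤ
Charge-remove-minPlus α 1≤d = diag α ∸ 1 , diag α ,
  HasCard-resp (λ x → mk⇔ (λ ((Sx , 0≤x) , x≢m) → (Sx , x≢m) , 0≤x)
                          (λ ((Sx , x≢m) , 0≤x) → (Sx , 0≤x) , x≢m))
    (HasCard-remove (HasCard-Plus-maya α) (proj₁ (minPlus-maya α 1≤d))) ,
  HasCard-resp (λ x → mk⇔ (λ (x∉S , x<0) → (λ (Sx , _) → x∉S Sx) , x<0)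
                          (λ (x∉S′ , x<0) → (λ Sx → x∉S′ (Sx , x≢m x<0)) , x<0))
    (HasCard-Minus-maya α) ,
  -1ℤ≡diff 1≤d
  where
  -1ℤ≡diff : ∀ {d} → 1 ≤ d → -1ℤ ≡ + (d ∸ 1) - + d
  -1ℤ≡diff {suc e} _ = sym (from (diff≡diff⇔ e (suc e) 0 1) (ℕ.+-comm e 1))
  x≢m : ∀ {x} → x ℤ.< 0ℤ → x ≢ bead α (diag α)
  x≢m x<0 refl = ℤ.<⇒≱ x<0 (proj₂ (proj₁ (minPlus-maya α 1≤d)))

-- Removing a bead

nth-applyUpTo : ∀ (h : ℕ → ℕ) {n i} → i < n → nth (applyUpTo h n) i ≡ h i
nth-applyUpTo h {suc n} {zero}  _         = refl
nth-applyUpTo h {suc n} {suc i} (s≤s i<n) = nth-applyUpTo (h ∘ suc) i<n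

fromAntitone : (h : ℕ → ℕ) (n : ℕ) → (∀ i → h (suc i) ≤ h i) → (∀ {i} → i < n → 0 < h i) →
  Partition
fromAntitone h n h-antitone h-positive =
  mkPartition (applyUpTo h n) (LinkedP.applyUpTo⁺₂ h n h-antitone) (AllP.applyUpTo⁺₁ h n h-positive)

shiftedPart : Partition → ℕ → ℕ → ℕ
shiftedPart μ d t with t <? d
... | yes _ = suc (part μ t)
... | no  _ = part μ (suc t)

shiftedPart-< : ∀ μ {d t} → t < d → shiftedPart μ d t ≡ suc (part μ t)
shiftedPart-< μ {d} {t} t<d with t <? d
... | yes _   = refl
... | no  t≮d = contradiction t<d t≮d

shiftedPart-≥ : ∀ μ {d t} → d ≤ t → shiftedPart μ d t ≡ part μ (suc t)
shiftedPart-≥ μ {d} {t} d≤t with t <? d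
... | yes t<d = contradiction d≤t (ℕ.<⇒≱ t<d)
... | no  _   = refl

shiftedPart-antitone : ∀ μ d t → shiftedPart μ d (suc t) ≤ shiftedPart μ d t
shiftedPart-antitone μ d t = by-cases (suc t <? d) (t <? d)
  where
  by-cases : Dec (suc t < d) → Dec (t < d) → shiftedPart μ d (suc t) ≤ shiftedPart μ d t
  by-cases (yes t+1<d) _ = subst₂ _≤_
    (sym (shiftedPart-< μ t+1<d)) (sym (shiftedPart-< μ (ℕ.<-trans (ℕ.n<1+n t) t+1<d)))
    (s≤s (part-antitone μ (ℕ.n≤1+n t)))
  by-cases (no t+1≮d) (yes t<d) = subst₂ _≤_
    (sym (shiftedPart-≥ μ (ℕ.≮⇒≥ t+1≮d))) (sym (shiftedPart-< μ t<d))
    (ℕ.≤-trans (part-antitone μ (ℕ.m≤n+m t 2)) (ℕ.n≤1+n _))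
  by-cases (no t+1≮d) (no t≮d) = subst₂ _≤_
    (sym (shiftedPart-≥ μ (ℕ.≮⇒≥ t+1≮d))) (sym (shiftedPart-≥ μ (ℕ.≮⇒≥ t≮d)))
    (part-antitone μ (ℕ.n≤1+n (suc t)))

removeBead : Partition → ℕ → Partition
removeBead μ d =
  fromAntitone (shiftedPart μ d ∘ suc) (pred (len μ)) (shiftedPart-antitone μ d ∘ suc) shifted-positive
  where
  shifted-positive : ∀ {i} → i < pred (len μ) → 0 < shiftedPart μ d (suc i)
  shifted-positive {i} i<N-1 with suc i <? d
  ... | yes _ = s≤s z≤n
  ... | no  _ = part-positive μ (s≤s z≤n) (ℕ.pred-cancel-< i<N-1)

module _ (μ : Partition) {d : ℕ} (1≤d : 1 ≤ d) (d≤len : d ≤ len μ) where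

  private
    ν : Partition
    ν = removeBead μ d

    N : ℕ
    N = len μ

    pred≤⇒≤suc : ∀ {n i} → pred n ≤ i → n ≤ suc i
    pred≤⇒≤suc {zero}  _   = z≤n
    pred≤⇒≤suc {suc n} n≤i = s≤s n≤i

  part-removeBead-< : ∀ {t} → 1 ≤ t → t < d → part ν t ≡ suc (part μ t)
  part-removeBead-< {suc i} _ t<d =
    trans (nth-applyUpTo (shiftedPart μ d ∘ suc) (ℕ.<⇒≤pred (ℕ.<-≤-trans t<d d≤len)))
      (shiftedPart-< μ t<d)

  part-removeBead-≥ : ∀ {t} → 1 ≤ t → d ≤ t → part ν t ≡ part μ (suc t)
  part-removeBead-≥ {suc i} _ d≤t with i <? pred N
  ... | yes i<N-1 = trans (nth-applyUpTo (shiftedPart μ d ∘ suc) i<N-1) (shiftedPart-≥ μ d≤t)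
  ... | no  i≮N-1 = trans (nth-beyond (applyUpTo (shiftedPart μ d ∘ suc) (pred N))
      (subst (_≤ i) (sym (length-applyUpTo _ (pred N))) (ℕ.≮⇒≥ i≮N-1)))
    (sym (part-beyond μ (s≤s (pred≤⇒≤suc (ℕ.≮⇒≥ i≮N-1)))))

  private
    bead-removeBead-< : ∀ {t} → 1 ≤ t → t < d → bead ν t ≡ bead μ t ℤ.+ 1ℤ
    bead-removeBead-< {t} 1≤t t<d =
      trans (cong (λ p → + p - + t) (part-removeBead-< 1≤t t<d)) (suc-diff (part μ t) t)

    bead-removeBead-≥ : ∀ {t} → 1 ≤ t → d ≤ t → bead ν t ≡ bead μ (suc t) ℤ.+ 1ℤ
    bead-removeBead-≥ {t} 1≤t d≤t =
      trans (cong (λ p → + p - + t) (part-removeBead-≥ 1≤t d≤t)) (diff-suc (part μ (suc t)) t)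

  maya-removeBead : ∀ x →
    maya ν x ⇔ (Σ ℤ λ s → remove (maya μ) (bead μ d) s × x ≡ s ℤ.+ 1ℤ)
  maya-removeBead x = mk⇔ to-shifted from-shifted
    where
    to-shifted : maya ν x → Σ ℤ λ s → remove (maya μ) (bead μ d) s × x ≡ s ℤ.+ 1ℤ
    to-shifted (t , 1≤t , refl) with t <? d
    ... | yes t<d = bead μ t , ((t , 1≤t , refl) , bead-distinct μ t<d) , bead-removeBead-< 1≤t t<d
    ... | no  t≮d = bead μ (suc t) ,
      ((suc t , s≤s z≤n , refl) , bead-distinct μ (s≤s (ℕ.≮⇒≥ t≮d)) ∘ sym) ,
      bead-removeBead-≥ 1≤t (ℕ.≮⇒≥ t≮d)
    from-shifted : (Σ ℤ λ s → remove (maya μ) (bead μ d) s × x ≡ s ℤ.+ 1ℤ) → maya ν x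
    from-shifted (_ , ((t , 1≤t , refl) , bt≢bd) , refl) with ℕ.<-cmp t d
    ... | tri< t<d _ _ = t , 1≤t , bead-removeBead-< 1≤t t<d
    ... | tri≈ _ refl _ = contradiction refl bt≢bd
    ... | tri> _ _ d<t with t | d<t
    ...   | suc t′ | s≤s d≤t′ = t′ , 1≤t′ , bead-removeBead-≥ 1≤t′ d≤t′
      where
      1≤t′ : 1 ≤ t′
      1≤t′ = ℕ.≤-trans 1≤d d≤t′

removeBead-isMuR : ∀ μ → 1 ≤ diag μ → IsMuR μ (removeBead μ (diag μ))
removeBead-isMuR μ 1≤d =
  bead μ (diag μ) , minPlus-maya μ 1≤d ,
  -1ℤ , Charge-remove-minPlus μ 1≤d , maya-removeBead μ 1≤d (diag≤len μ)

diag-removeBead⇔ : ∀ μ → 1 ≤ diag μ →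
  (diag (removeBead μ (diag μ)) ≡ diag μ) ⇔ (part μ (suc (diag μ)) ≡ diag μ)
diag-removeBead⇔ μ 1≤d = mk⇔
  (λ diagν≡d → ℕ.≤-antisym (part-suc-diag≤diag μ)
    (subst (d ≤_) νd≡μd+1 (subst (λ k → k ≤ part ν k) diagν≡d (diag-≤-part ν))))
  (λ μd+1≡d → diag-unique ν
    (ℕ.≤-reflexive (sym (trans νd≡μd+1 μd+1≡d)))
    (subst (_≤ d) (sym νd+1≡μd+2)
      (ℕ.≤-trans (part-antitone μ (ℕ.n≤1+n _)) (ℕ.≤-reflexive μd+1≡d))))
  where
  d : ℕ
  d = diag μ
  ν : Partition
  ν = removeBead μ d
  νd≡μd+1 : part ν d ≡ part μ (suc d)
  νd≡μd+1 = part-removeBead-≥ μ 1≤d (diag≤len μ) 1≤d ℕ.≤-refl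
  νd+1≡μd+2 : part ν (suc d) ≡ part μ (suc (suc d))
  νd+1≡μd+2 = part-removeBead-≥ μ 1≤d (diag≤len μ) (s≤s z≤n) (ℕ.n≤1+n d)

lemma5p13 : (μ : Partition) → Nonempty μ →
    Σ Partition (IsMuR μ) ×
    ((ν : Partition) → IsMuR μ ν →
      (diag ν ≡ diag μ) ⇔ (part μ (suc (diag μ)) ≡ diag μ))
lemma5p13 μ nonempty = (μʳ , μʳ-isMuR) , λ ν ν-isMuR →
  subst (λ k → (k ≡ diag μ) ⇔ (part μ (suc (diag μ)) ≡ diag μ))
    (diag-cong μʳ ν (IsMuR-unique μ μʳ ν μʳ-isMuR ν-isMuR))
    (diag-removeBead⇔ μ 1≤d)
  where
  1≤d : 1 ≤ diag μ
  1≤d = ≤-diag μ (part-positive μ ℕ.≤-refl nonempty)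
  μʳ : Partition
  μʳ = removeBead μ (diag μ)
  μʳ-isMuR : IsMuR μ μʳ
  μʳ-isMuR = removeBead-isMuR μ 1≤d
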